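{- Let $\mathcal{K}$ be a Fraïssé class whose Fraïssé symmetry $(\mathbb{D}_\mathcal{K},G_\mathcal{K})$ is well-behaved. For $\mathfrak{A}\in\mathcal{K}$ and a subgroup $S\le\mathrm{Aut}(\mathfrak{A})$, let $[\![\mathfrak{A},S]\!]$ be the set of embeddings $u:\mathfrak{A}\to\mathfrak{U}_\mathcal{K}$ quotiented by $u\equiv_S v\iff v=u\circ\sigma$ for some $\sigma\in S$, with $G_\mathcal{K}$-action $[u]\cdot\pi=[\pi\circ u]$. Then: (1) $[\![\mathfrak{A},S]\!]$ is a single-orbit nominal $G_\mathcal{K}$-set; (2) every single-orbit nominal $G_\mathcal{K}$-set is isomorphic to $[\![\mathfrak{A},S]\!]$ for some $\mathfrak{A}\in\mathcal{K}$ and $S\le\mathrm{Aut}(\mathfrak{A})$.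
   Context: Fix a finite relational signature. An embedding of structures is an injective map preserving and reflecting all relations. A Fraïssé class $\mathcal{K}$ is a class of finite structures closed under isomorphism and substructures, with amalgamation: for embeddings $f_\mathfrak{B}:\mathfrak{A}\to\mathfrak{B}$, $f_\mathfrak{C}:\mathfrak{A}\to\mathfrak{C}$ with $\mathfrak{A},\mathfrak{B},\mathfrak{C}\in\mathcal{K}$ there are $\mathfrak{D}\in\mathcal{K}$ and embeddings $g_\mathfrak{B}:\mathfrak{B}\to\mathfrak{D}$, $g_\mathfrak{C}:\mathfrak{C}\to\mathfrak{D}$ with $g_\mathfrak{B}f_\mathfrak{B}=g_\mathfrak{C}f_\mathfrak{C}$. Its Fraïssé limit $\mathfrak{U}_\mathcal{K}$ is the (unique up to isomorphism) countable structure whose finite substructures are, up to isomorphism, exactly the members of $\mathcal{K}$ and which is homogeneous (every isomorphism between finite substructures extends to an automorphism). $\mathbb{D}_\mathcal{K}$ is its carrier and $G_\mathcal{K}=\mathrm{Aut}(\mathfrak{U}_\mathcal{K})$. A $G_\mathcal{K}$-set is nominal if every element $x$ has a finite $C\subseteq\mathbb{D}_\mathcal{K}$ with $x\cdot\pi=x$ for all $\pi\in G_\mathcal{K}$ fixing $C$ pointwise. The symmetry is well-behaved if (i) every element of every nominal $G_\mathcal{K}$-set has a least finite support and (ii) every finite $C\subseteq\mathbb{D}_\mathcal{K}$ is fungible, i.e. for every $c\in C$ some $\pi\in G_\mathcal{K}$ moves $c$ and fixes every element of $C\setminus\{c\}$. -}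

module Defs where

open import Level using (0ℓ)
open import Data.Nat using (ℕ)
open import Data.Fin using (Fin)
open import Data.Vec using (Vec; map)
open import Data.Vec.Properties using (map-∘; map-cong; map-id)
open import Data.List using (List)
open import Data.List.Membership.Propositional using (_∈_)
open import Data.Product using (Σ; _×_; _,_; proj₁; proj₂)
open import Function using (_∘_; id)
open import Relation.Binary.Bundles using (Setoid)
open import Relation.Binary.PropositionalEquality
  using (_≡_; _≢_; refl; sym; trans; cong; subst)

record Signature : Set where
  field
    nrel  : ℕ
    arity : Fin nrel → ℕ
open Signature public

record Structure (Sig : Signature) : Set₁ where
  field
    Carrier : Set
    rel     : (i : Fin (nrel Sig)) → Vec Carrier (arity Sig i) → Set
open Structure public

record FinStruct (Sig : Signature) : Set₁ where
  field
    size : ℕ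
    frel : (i : Fin (nrel Sig)) → Vec (Fin size) (arity Sig i) → Set
open FinStruct public

⟪_⟫ : ∀ {Sig} → FinStruct Sig → Structure Sig
⟪ A ⟫ = record { Carrier = Fin (size A) ; rel = frel A }

_⇔_ : Set → Set → Set
P ⇔ Q = (P → Q) × (Q → P)

PresRefl : ∀ {Sig} (M N : Structure Sig) → (Carrier M → Carrier N) → Set
PresRefl {Sig} M N f =
  ∀ (i : Fin (nrel Sig)) (xs : Vec (Carrier M) (arity Sig i)) →
    rel M i xs ⇔ rel N i (map f xs)

record Embedding {Sig} (M N : Structure Sig) : Set where
  field
    emb     : Carrier M → Carrier N
    emb-inj : ∀ x y → emb x ≡ emb y → x ≡ y
    emb-pres : PresRefl M N emb
open Embedding public

record Iso {Sig} (M N : Structure Sig) : Set where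
  field
    to      : Carrier M → Carrier N
    from    : Carrier N → Carrier M
    from-to : ∀ x → from (to x) ≡ x
    to-from : ∀ y → to (from y) ≡ y
    to-pres : PresRefl M N to
open Iso public

Aut : ∀ {Sig} → Structure Sig → Set
Aut M = Iso M M

module _ {Sig : Signature} {M : Structure Sig} where

  idAut : Aut M
  idAut = record
    { to = id ; from = id ; from-to = λ _ → refl ; to-from = λ _ → refl
    ; to-pres = λ i xs →
        (λ r → subst (rel M i) (sym (map-id xs)) r)
      , (λ r → subst (rel M i) (map-id xs) r) }

  -- π ⨾ σ : first π, then σ  (so that x · (π ⨾ σ) = (x · π) · σ)
  _⨾_ : Aut M → Aut M → Aut M
  π ⨾ σ = record
    { to = to σ ∘ to π
    ; from = from π ∘ from σ
    ; from-to = λ x → trans (cong (from π) (from-to σ (to π x))) (from-to π x)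
    ; to-from = λ y → trans (cong (to σ) (to-from π (from σ y))) (to-from σ y)
    ; to-pres = λ i xs →
        (λ r → subst (rel M i) (sym (map-∘ (to σ) (to π) xs))
                 (proj₁ (to-pres σ i (map (to π) xs)) (proj₁ (to-pres π i xs) r)))
      , (λ r → proj₂ (to-pres π i xs) (proj₂ (to-pres σ i (map (to π) xs))
                 (subst (rel M i) (map-∘ (to σ) (to π) xs) r))) }

  _⁻¹ : Aut M → Aut M
  π ⁻¹ = record
    { to = from π ; from = to π ; from-to = to-from π ; to-from = from-to π
    ; to-pres = λ i xs →
        (λ r → proj₂ (to-pres π i (map (from π) xs)) (subst (rel M i) (sym (eq xs)) r))
      , (λ r → subst (rel M i) (eq xs) (proj₁ (to-pres π i (map (from π) xs)) r)) }
    where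
      eq : ∀ {k} (xs : Vec (Carrier M) k) → map (to π) (map (from π) xs) ≡ xs
      eq xs = trans (sym (map-∘ (to π) (from π) xs))
                    (trans (map-cong (to-from π) xs) (map-id xs))

record Subgroup {Sig} (M : Structure Sig) : Set₁ where
  field
    member      : Aut M → Set
    member-ext  : ∀ {σ τ} → member σ → (∀ x → to σ x ≡ to τ x) → member τ
    member-id   : member idAut
    member-comp : ∀ {σ τ} → member σ → member τ → member (σ ⨾ τ)
    member-inv  : ∀ {σ} → member σ → member (σ ⁻¹)
open Subgroup public

module _ {Sig : Signature} where

  record IsFraisseClass (K : FinStruct Sig → Set) : Set₁ where
    field
      iso-closed  : ∀ {A B} → K A → Iso ⟪ A ⟫ ⟪ B ⟫ → K B
      sub-closed  : ∀ {A B} → K B → Embedding ⟪ A ⟫ ⟪ B ⟫ → K A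
      amalgamation :
        ∀ {A B C} → K A → K B → K C →
        (fB : Embedding ⟪ A ⟫ ⟪ B ⟫) (fC : Embedding ⟪ A ⟫ ⟪ C ⟫) →
        Σ (FinStruct Sig) λ D → K D ×
        Σ (Embedding ⟪ B ⟫ ⟪ D ⟫) λ gB → Σ (Embedding ⟪ C ⟫ ⟪ D ⟫) λ gC →
          ∀ a → emb gB (emb fB a) ≡ emb gC (emb fC a)

  record IsFraisseLimit (K : FinStruct Sig → Set) (U : Structure Sig) : Set₁ where
    field
      count     : Carrier U → ℕ
      count-inj : ∀ x y → count x ≡ count y → x ≡ y
      age       : ∀ (A : FinStruct Sig) → K A ⇔ Embedding ⟪ A ⟫ U
      -- homogeneity: every isomorphism between finite substructures
      -- (presented as two embeddings of one finite structure) extends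
      -- to an automorphism of U
      homogeneous : ∀ (A : FinStruct Sig) (u v : Embedding ⟪ A ⟫ U) →
        Σ (Aut U) λ π → ∀ a → to π (emb u a) ≡ emb v a

record GSet {Sig} (U : Structure Sig) : Set₁ where
  field
    setoid : Setoid 0ℓ 0ℓ
  open Setoid setoid public renaming (Carrier to Elt)
  field
    act      : Elt → Aut U → Elt
    act-cong : ∀ {x y π σ} → x ≈ y → (∀ d → to π d ≡ to σ d) → act x π ≈ act y σ
    act-id   : ∀ x → act x idAut ≈ x
    act-comp : ∀ x π σ → act x (π ⨾ σ) ≈ act (act x π) σ

module _ {Sig : Signature} {U : Structure Sig} where

  Supports : (X : GSet U) → List (Carrier U) → GSet.Elt X → Set
  Supports X C x = ∀ (π : Aut U) → (∀ c → c ∈ C → to π c ≡ c) →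
                   GSet._≈_ X (GSet.act X x π) x

  IsNominal : GSet U → Set
  IsNominal X = ∀ x → Σ (List (Carrier U)) λ C → Supports X C x

  HasLeastSupport : (X : GSet U) → GSet.Elt X → Set
  HasLeastSupport X x = Σ (List (Carrier U)) λ C → Supports X C x ×
    (∀ C′ → Supports X C′ x → ∀ c → c ∈ C → c ∈ C′)

  Fungible : List (Carrier U) → Set
  Fungible C = ∀ c → c ∈ C → Σ (Aut U) λ π → to π c ≢ c ×
                 (∀ d → d ∈ C → d ≢ c → to π d ≡ d)

  WellBehaved : Set₁
  WellBehaved =
    (∀ (X : GSet U) → IsNominal X → ∀ x → HasLeastSupport X x) ×
    (∀ (C : List (Carrier U)) → Fungible C)

  SingleOrbit : GSet U → Set
  SingleOrbit X = GSet.Elt X ×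
    (∀ x y → Σ (Aut U) λ π → GSet._≈_ X (GSet.act X x π) y)

  record GSetIso (X Y : GSet U) : Set where
    private
      module X = GSet X
      module Y = GSet Y
    field
      f      : X.Elt → Y.Elt
      g      : Y.Elt → X.Elt
      f-cong : ∀ {x x′} → x X.≈ x′ → f x Y.≈ f x′
      g-cong : ∀ {y y′} → y Y.≈ y′ → g y X.≈ g y′
      f-g    : ∀ y → f (g y) Y.≈ y
      g-f    : ∀ x → g (f x) X.≈ x
      equivariant : ∀ x π → f (X.act x π) Y.≈ Y.act (f x) π

  module _ (A : FinStruct Sig) (S : Subgroup ⟪ A ⟫) where

    _∼S_ : Embedding ⟪ A ⟫ U → Embedding ⟪ A ⟫ U → Set
    u ∼S v = Σ (Aut ⟪ A ⟫) λ σ → member S σ × (∀ a → emb v a ≡ emb u (to σ a))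

    postcomp : Embedding ⟪ A ⟫ U → Aut U → Embedding ⟪ A ⟫ U
    postcomp u π = record
      { emb = to π ∘ emb u
      ; emb-inj = λ x y e → emb-inj u x y
          (trans (sym (from-to π (emb u x))) (trans (cong (from π) e) (from-to π (emb u y))))
      ; emb-pres = λ i xs →
          (λ r → subst (rel U i) (sym (map-∘ (to π) (emb u) xs))
                   (proj₁ (to-pres π i (map (emb u) xs)) (proj₁ (emb-pres u i xs) r)))
        , (λ r → proj₂ (emb-pres u i xs) (proj₂ (to-pres π i (map (emb u) xs))
                   (subst (rel U i) (map-∘ (to π) (emb u) xs) r))) }

    ⟦_,_⟧ : GSet U
    ⟦_,_⟧ = record
      { setoid = record
          { Carrier = Embedding ⟪ A ⟫ U
          ; _≈_ = _∼S_
          ; isEquivalence = record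
              { refl = λ {u} → idAut , member-id S , (λ a → refl)
              ; sym = λ { {u} {v} (σ , m , h) → (σ ⁻¹) , member-inv S m ,
                  (λ a → sym (trans (h (from σ a)) (cong (emb u) (to-from σ a)))) }
              ; trans = λ { {u} {v} {w} (σ , m , h) (τ , m′ , h′) →
                  (τ ⨾ σ) , member-comp S m′ m , (λ a → trans (h′ a) (h (to τ a))) }
              } }
      ; act = postcomp
      ; act-cong = λ { {u} {v} {π} {π′} (σ , m , h) eq → σ , m ,
          (λ a → trans (sym (eq (emb v a))) (cong (to π) (h a))) }
      ; act-id = λ u → idAut , member-id S , (λ a → refl)
      ; act-comp = λ u π σ → idAut , member-id S , (λ a → refl)
      }

-- (1) The image of u supports [u], and by homogeneity any two embeddings of A
-- differ by an automorphism of U.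
-- (2) Enumerate the least support of a point x₀ of the orbit by an embedding
-- u : A → U.  The stabiliser of x₀ permutes its least support, so its elements
-- restrict along u to automorphisms of A, which form S.  Since x₀ · π depends
-- only on the class of π ∘ u modulo S, x₀ · π ↦ [π ∘ u] is a well-defined
-- equivariant injection, and homogeneity makes it surjective.
module Submission where

open import Defs
open import Data.Nat.Properties using (eq?)
open import Data.Fin using (Fin; zero; suc)
open import Data.Vec using (Vec; map)
open import Data.Vec.Properties using (map-∘; map-cong)
open import Data.List using (List; _∷_; length; lookup; deduplicate; allFin)
import Data.List as List
open import Data.List.Membership.Propositional using (_∈_)
open import Data.List.Membership.Propositional.Properties
  using (∈-lookup; ∈-allFin; ∈-deduplicate⁺; ∈-deduplicate⁻; ∈-map⁺; ∈-map⁻)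
open import Data.List.Relation.Binary.Subset.Propositional using (_⊆_)
open import Data.List.Relation.Unary.All as All using ()
open import Data.List.Relation.Unary.AllPairs using (_∷_)
open import Data.List.Relation.Unary.Any using (index)
open import Data.List.Relation.Unary.Any.Properties using (lookup-index)
open import Data.List.Relation.Unary.Unique.Propositional using (Unique)
open import Data.List.Relation.Unary.Unique.DecPropositional.Properties
  using (deduplicate-!)
open import Data.Product using (Σ; _×_; _,_; proj₁; proj₂)
open import Data.Empty using (⊥-elim)
open import Function using (_∘_; id)
open import Function.Bundles using (mk↣)
open import Relation.Binary.Bundles using (Setoid)
open import Relation.Binary.Definitions using (DecidableEquality)
open import Relation.Binary.PropositionalEquality
  using (_≡_; refl; sym; trans; cong; subst; module ≡-Reasoning)
import Relation.Binary.Reasoning.Setoid as SetoidReasoning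

lookup-injective : ∀ {X : Set} {xs : List X} → Unique xs →
  ∀ i j → lookup xs i ≡ lookup xs j → i ≡ j
lookup-injective {xs = x ∷ xs} _         zero    zero    _ = refl
lookup-injective {xs = x ∷ xs} (x∉ ∷ _)  zero    (suc j) e = ⊥-elim (All.lookup x∉ (∈-lookup j) e)
lookup-injective {xs = x ∷ xs} (x∉ ∷ _)  (suc i) zero    e = ⊥-elim (All.lookup x∉ (∈-lookup i) (sym e))
lookup-injective {xs = x ∷ xs} (_ ∷ !xs) (suc i) (suc j) e = cong suc (lookup-injective !xs i j e)

∈⇒lookup : ∀ {X : Set} {xs : List X} {x : X} → x ∈ xs →
  Σ (Fin (length xs)) λ i → lookup xs i ≡ x
∈⇒lookup x∈ = index x∈ , sym (lookup-index x∈)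

⇔-sym : ∀ {P Q} → P ⇔ Q → Q ⇔ P
⇔-sym (f , g) = g , f

⇔-trans : ∀ {P Q R} → P ⇔ Q → Q ⇔ R → P ⇔ R
⇔-trans (f , g) (f′ , g′) = f′ ∘ f , g ∘ g′

≡⇒⇔ : ∀ {P Q} → P ≡ Q → P ⇔ Q
≡⇒⇔ refl = id , id

module _ {Sig : Signature} {U : Structure Sig} where

  Homogeneous : Set₁
  Homogeneous = ∀ (A : FinStruct Sig) (u v : Embedding ⟪ A ⟫ U) →
    Σ (Aut U) λ π → ∀ a → to π (emb u a) ≡ emb v a

  image : ∀ {A : FinStruct Sig} → Embedding ⟪ A ⟫ U → List (Carrier U)
  image {A} u = List.map (emb u) (allFin (size A))

  ∈-image⁺ : ∀ {A} (u : Embedding ⟪ A ⟫ U) a → emb u a ∈ image u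
  ∈-image⁺ u a = ∈-map⁺ (emb u) (∈-allFin a)

  ∈-image⁻ : ∀ {A} (u : Embedding ⟪ A ⟫ U) {c} → c ∈ image u →
    Σ (Fin (size A)) λ a → emb u a ≡ c
  ∈-image⁻ u c∈ with ∈-map⁻ (emb u) c∈
  ... | a , _ , c≡ua = a , sym c≡ua

  induced : List (Carrier U) → FinStruct Sig
  induced xs = record { size = length xs ; frel = λ i as → rel U i (map (lookup xs) as) }

  inclusion : ∀ {xs} → Unique xs → Embedding ⟪ induced xs ⟫ U
  inclusion {xs} !xs = record
    { emb = lookup xs ; emb-inj = lookup-injective !xs ; emb-pres = λ _ _ → id , id }

  inclusion-image⁺ : ∀ {xs} (!xs : Unique xs) → xs ⊆ image (inclusion !xs)
  inclusion-image⁺ !xs x∈ with ∈⇒lookup x∈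
  ... | i , refl = ∈-image⁺ (inclusion !xs) i

  inclusion-image⁻ : ∀ {xs} (!xs : Unique xs) → image (inclusion !xs) ⊆ xs
  inclusion-image⁻ !xs x∈ with ∈-image⁻ (inclusion !xs) x∈
  ... | i , refl = ∈-lookup i

  restrictAut : ∀ {M : Structure Sig} (u : Embedding M U) (ρ : Aut U) →
    (∀ a → Σ (Carrier M) λ b → emb u b ≡ to ρ (emb u a)) →
    (∀ a → Σ (Carrier M) λ b → emb u b ≡ from ρ (emb u a)) →
    Σ (Aut M) λ σ → ∀ a → emb u (to σ a) ≡ to ρ (emb u a)
  restrictAut {M} u ρ ρ-image ρ⁻¹-image = σ , t-spec
    where
      open ≡-Reasoning
      t f : Carrier M → Carrier M
      t = proj₁ ∘ ρ-image
      f = proj₁ ∘ ρ⁻¹-image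
      t-spec : ∀ a → emb u (t a) ≡ to ρ (emb u a)
      t-spec = proj₂ ∘ ρ-image
      f-spec : ∀ a → emb u (f a) ≡ from ρ (emb u a)
      f-spec = proj₂ ∘ ρ⁻¹-image

      map-t : ∀ {k} (xs : Vec (Carrier M) k) →
        map (to ρ) (map (emb u) xs) ≡ map (emb u) (map t xs)
      map-t xs = begin
        map (to ρ) (map (emb u) xs)  ≡⟨ map-∘ (to ρ) (emb u) xs ⟨
        map (to ρ ∘ emb u) xs        ≡⟨ map-cong (sym ∘ t-spec) xs ⟩
        map (emb u ∘ t) xs           ≡⟨ map-∘ (emb u) t xs ⟩
        map (emb u) (map t xs)       ∎

      σ : Aut M
      σ = record
        { to = t
        ; from = f
        ; from-to = λ a → emb-inj u _ _ (begin
            emb u (f (t a))           ≡⟨ f-spec (t a) ⟩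
            from ρ (emb u (t a))      ≡⟨ cong (from ρ) (t-spec a) ⟩
            from ρ (to ρ (emb u a))   ≡⟨ from-to ρ (emb u a) ⟩
            emb u a                   ∎)
        ; to-from = λ a → emb-inj u _ _ (begin
            emb u (t (f a))           ≡⟨ t-spec (f a) ⟩
            to ρ (emb u (f a))        ≡⟨ cong (to ρ) (f-spec a) ⟩
            to ρ (from ρ (emb u a))   ≡⟨ to-from ρ (emb u a) ⟩
            emb u a                   ∎)
        ; to-pres = λ i xs →
            ⇔-trans (emb-pres u i xs)
            (⇔-trans (to-pres ρ i (map (emb u) xs))
            (⇔-trans (≡⇒⇔ (cong (rel U i) (map-t xs)))
                     (⇔-sym (emb-pres u i (map t xs)))))
        }

  restrictSubgroup : ∀ {M : Structure Sig} → Embedding M U → Subgroup U → Subgroup M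
  restrictSubgroup u H = record
    { member = λ σ → Σ (Aut U) λ ρ → member H ρ × (∀ a → emb u (to σ a) ≡ to ρ (emb u a))
    ; member-ext = λ { (ρ , ρ∈H , σ-spec) σ≗τ →
        ρ , ρ∈H , λ a → trans (cong (emb u) (sym (σ≗τ a))) (σ-spec a) }
    ; member-id = idAut , member-id H , λ _ → refl
    ; member-comp = λ { {σ} (ρ , ρ∈H , σ-spec) (ρ′ , ρ′∈H , τ-spec) →
        (ρ ⨾ ρ′) , member-comp H ρ∈H ρ′∈H ,
        λ a → trans (τ-spec (to σ a)) (cong (to ρ′) (σ-spec a)) }
    ; member-inv = λ { {σ} (ρ , ρ∈H , σ-spec) →
        (ρ ⁻¹) , member-inv H ρ∈H , λ a → sym (begin
          from ρ (emb u a)                     ≡⟨ cong (from ρ ∘ emb u) (to-from σ a) ⟨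
          from ρ (emb u (to σ (from σ a)))     ≡⟨ cong (from ρ) (σ-spec (from σ a)) ⟩
          from ρ (to ρ (emb u (from σ a)))     ≡⟨ from-to ρ _ ⟩
          emb u (from σ a)                     ∎) }
    }
    where open ≡-Reasoning

  ⟦⟧-nominal : (A : FinStruct Sig) (S : Subgroup ⟪ A ⟫) → IsNominal (⟦_,_⟧ {U = U} A S)
  ⟦⟧-nominal A S v = image v , λ π π-fixes →
    idAut , member-id S , λ a → sym (π-fixes (emb v a) (∈-image⁺ v a))

  ⟦⟧-singleOrbit : Homogeneous → (A : FinStruct Sig) (S : Subgroup ⟪ A ⟫) →
    Embedding ⟪ A ⟫ U → SingleOrbit (⟦_,_⟧ {U = U} A S)
  ⟦⟧-singleOrbit homogeneous A S u = u , λ v w →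
    let (π , πv≡w) = homogeneous A v w in
    π , idAut , member-id S , λ a → sym (πv≡w a)

  module _ (X : GSet U) where
    open GSet X using (Elt; _≈_; act; act-cong; act-id; act-comp; setoid)
    open Setoid setoid using () renaming (refl to ≈-refl)
    open SetoidReasoning setoid

    act-inverse : ∀ x ρ → act (act x ρ) (ρ ⁻¹) ≈ x
    act-inverse x ρ = begin
      act (act x ρ) (ρ ⁻¹)  ≈⟨ act-comp x ρ (ρ ⁻¹) ⟨
      act x (ρ ⨾ (ρ ⁻¹))    ≈⟨ act-cong ≈-refl (from-to ρ) ⟩
      act x idAut           ≈⟨ act-id x ⟩
      x                     ∎

    stabiliser : Elt → Subgroup U
    stabiliser x = record
      { member = λ ρ → act x ρ ≈ x
      ; member-ext = λ {ρ} {τ} ρ∈ ρ≗τ → begin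
          act x τ  ≈⟨ act-cong ≈-refl (sym ∘ ρ≗τ) ⟩
          act x ρ  ≈⟨ ρ∈ ⟩
          x        ∎
      ; member-id = act-id x
      ; member-comp = λ {ρ} {τ} ρ∈ τ∈ → begin
          act x (ρ ⨾ τ)      ≈⟨ act-comp x ρ τ ⟩
          act (act x ρ) τ    ≈⟨ act-cong ρ∈ (λ _ → refl) ⟩
          act x τ            ≈⟨ τ∈ ⟩
          x                  ∎
      ; member-inv = λ {ρ} ρ∈ → begin
          act x (ρ ⁻¹)          ≈⟨ act-cong ρ∈ (λ _ → refl) ⟨
          act (act x ρ) (ρ ⁻¹)  ≈⟨ act-inverse x ρ ⟩
          x                     ∎
      }

    act≈⇒stabiliser : ∀ {x} α β → act x α ≈ act x β → member (stabiliser x) (α ⨾ (β ⁻¹))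
    act≈⇒stabiliser {x} α β xα≈xβ = begin
      act x (α ⨾ (β ⁻¹))    ≈⟨ act-comp x α (β ⁻¹) ⟩
      act (act x α) (β ⁻¹)  ≈⟨ act-cong xα≈xβ (λ _ → refl) ⟩
      act (act x β) (β ⁻¹)  ≈⟨ act-inverse x β ⟩
      x                     ∎

    supports-agree : ∀ {C x} → Supports X C x →
      ∀ α β → (∀ c → c ∈ C → to α c ≡ to β c) → act x α ≈ act x β
    supports-agree {C} {x} C-supports α β α≗β = begin
      act x α                     ≈⟨ act-cong ≈-refl (λ d → sym (to-from β (to α d))) ⟩
      act x ((α ⨾ (β ⁻¹)) ⨾ β)    ≈⟨ act-comp x (α ⨾ (β ⁻¹)) β ⟩
      act (act x (α ⨾ (β ⁻¹))) β  ≈⟨ act-cong (C-supports (α ⨾ (β ⁻¹)) αβ⁻¹-fixes) (λ _ → refl) ⟩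
      act x β                     ∎
      where
        αβ⁻¹-fixes : ∀ c → c ∈ C → from β (to α c) ≡ c
        αβ⁻¹-fixes c c∈ = trans (cong (from β) (α≗β c c∈)) (from-to β c)

    supports-⊆ : ∀ {C C′ x} → C ⊆ C′ → Supports X C x → Supports X C′ x
    supports-⊆ C⊆C′ C-supports π π-fixes = C-supports π (λ c → π-fixes c ∘ C⊆C′)

    supports-act : ∀ {C x} ρ → Supports X C x → Supports X (List.map (to ρ) C) (act x ρ)
    supports-act {C} {x} ρ C-supports π π-fixes = begin
      act (act x ρ) π    ≈⟨ act-comp x ρ π ⟨
      act x (ρ ⨾ π)      ≈⟨ supports-agree C-supports (ρ ⨾ π) ρ
                              (λ c c∈ → π-fixes (to ρ c) (∈-map⁺ (to ρ) c∈)) ⟩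
      act x ρ            ∎

    supports-resp-≈ : ∀ {C x y} → x ≈ y → Supports X C x → Supports X C y
    supports-resp-≈ {x = x} {y} x≈y C-supports π π-fixes = begin
      act y π   ≈⟨ act-cong x≈y (λ _ → refl) ⟨
      act x π   ≈⟨ C-supports π π-fixes ⟩
      x         ≈⟨ x≈y ⟩
      y         ∎

    leastSupport-stable : ∀ {C x} → Supports X C x →
      (∀ C′ → Supports X C′ x → ∀ c → c ∈ C → c ∈ C′) →
      ∀ {ρ} → member (stabiliser x) ρ → ∀ {c} → c ∈ C → to ρ c ∈ C
    leastSupport-stable {C} C-supports C-least {ρ} ρ∈ {c} c∈
      with ∈-map⁻ (from ρ) (C-least _ ρ⁻¹C-supports c c∈)
      where
        ρ⁻¹C-supports : Supports X (List.map (from ρ) C) _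
        ρ⁻¹C-supports =
          supports-resp-≈ (member-inv (stabiliser _) ρ∈) (supports-act (ρ ⁻¹) C-supports)
    ... | c′ , c′∈ , refl = subst (_∈ C) (sym (to-from ρ c′)) c′∈

  module OrbitIso (homogeneous : Homogeneous) (X : GSet U)
    (x₀ : GSet.Elt X) (orbit : ∀ x → Σ (Aut U) λ π → GSet._≈_ X (GSet.act X x₀ π) x)
    (A : FinStruct Sig) (u : Embedding ⟪ A ⟫ U) (u-supports : Supports X (image u) x₀)
    (u-stable : ∀ {ρ} → member (stabiliser X x₀) ρ → ∀ {c} → c ∈ image u → to ρ c ∈ image u)
    where

    open GSet X using (Elt; _≈_; act; act-cong; act-comp; setoid)
    open Setoid setoid using () renaming (sym to ≈-sym)
    open SetoidReasoning setoid

    S : Subgroup ⟪ A ⟫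
    S = restrictSubgroup u (stabiliser X x₀)

    private
      module ⟦A,S⟧ = GSet (⟦_,_⟧ {U = U} A S)
      [_] : Aut U → Embedding ⟪ A ⟫ U
      [ π ] = postcomp A S u π

    restrictStabiliser : ∀ {ρ} → member (stabiliser X x₀) ρ →
      Σ (Aut ⟪ A ⟫) λ σ → ∀ a → emb u (to σ a) ≡ to ρ (emb u a)
    restrictStabiliser {ρ} ρ∈ = restrictAut u ρ
      (λ a → ∈-image⁻ u (u-stable ρ∈ (∈-image⁺ u a)))
      (λ a → ∈-image⁻ u (u-stable (member-inv (stabiliser X x₀) ρ∈) (∈-image⁺ u a)))

    act≈⇒∼ : ∀ α β → act x₀ α ≈ act x₀ β → [ α ] ⟦A,S⟧.≈ [ β ]
    act≈⇒∼ α β x₀α≈x₀β =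
      let ρ∈ = act≈⇒stabiliser X β α (≈-sym x₀α≈x₀β)
          (σ , σ-spec) = restrictStabiliser ρ∈
      in σ , (β ⨾ (α ⁻¹) , ρ∈ , σ-spec) ,
         λ a → trans (sym (to-from α _)) (cong (to α) (sym (σ-spec a)))

    ∼⇒act≈ : ∀ α β → [ α ] ⟦A,S⟧.≈ [ β ] → act x₀ α ≈ act x₀ β
    ∼⇒act≈ α β (σ , (ρ , ρ∈ , σ-spec) , βu≡ασ) = begin
      act x₀ α                ≈⟨ act-cong ρ∈ (λ _ → refl) ⟨
      act (act x₀ ρ) α        ≈⟨ act-comp x₀ ρ α ⟨
      act x₀ (ρ ⨾ α)          ≈⟨ supports-agree X u-supports (ρ ⨾ α) β ρα≗β ⟩
      act x₀ β                ∎
      where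
        ρα≗β : ∀ c → c ∈ image u → to α (to ρ c) ≡ to β c
        ρα≗β c c∈ with ∈-image⁻ u c∈
        ... | a , refl = trans (cong (to α) (sym (σ-spec a))) (sym (βu≡ασ a))

    private
      representative : Elt → Aut U
      representative x = proj₁ (orbit x)

      extension : Embedding ⟪ A ⟫ U → Aut U
      extension v = proj₁ (homogeneous A u v)

      extension-spec : ∀ v a → emb [ extension v ] a ≡ emb v a
      extension-spec v = proj₂ (homogeneous A u v)

      [extension]∼ : ∀ v → [ extension v ] ⟦A,S⟧.≈ v
      [extension]∼ v = idAut , member-id S , sym ∘ extension-spec v

      ∼[extension]⇒∼ : ∀ {w} v → w ⟦A,S⟧.≈ [ extension v ] → w ⟦A,S⟧.≈ v
      ∼[extension]⇒∼ v (σ , σ∈S , vσ≡w) =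
        σ , σ∈S , λ a → trans (sym (extension-spec v a)) (vσ≡w a)

      extension-cong : ∀ {v v′} → v ⟦A,S⟧.≈ v′ → [ extension v ] ⟦A,S⟧.≈ [ extension v′ ]
      extension-cong {v} {v′} (σ , σ∈S , v′≡vσ) = σ , σ∈S , λ a →
        trans (extension-spec v′ a) (trans (v′≡vσ a) (sym (extension-spec v (to σ a))))

    ≅⟦A,S⟧ : GSetIso X (⟦_,_⟧ {U = U} A S)
    ≅⟦A,S⟧ = record
      { f = λ x → [ representative x ]
      ; g = λ v → act x₀ (extension v)
      ; f-cong = λ {x} {x′} x≈x′ → act≈⇒∼ _ _ (begin
          act x₀ (representative x)   ≈⟨ proj₂ (orbit x) ⟩
          x                           ≈⟨ x≈x′ ⟩
          x′                          ≈⟨ proj₂ (orbit x′) ⟨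
          act x₀ (representative x′)  ∎)
      ; g-cong = λ v∼v′ → ∼⇒act≈ _ _ (extension-cong v∼v′)
      ; f-g = λ v → ∼[extension]⇒∼ {[ representative (act x₀ (extension v)) ]} v
          (act≈⇒∼ _ (extension v) (proj₂ (orbit _)))
      ; g-f = λ x → begin
          act x₀ (extension [ representative x ])  ≈⟨ ∼⇒act≈ _ _ ([extension]∼ _) ⟩
          act x₀ (representative x)                ≈⟨ proj₂ (orbit x) ⟩
          x                                        ∎
      ; equivariant = λ x π → act≈⇒∼ _ (representative x ⨾ π) (begin
          act x₀ (representative (act x π))   ≈⟨ proj₂ (orbit (act x π)) ⟩
          act x π                             ≈⟨ act-cong (proj₂ (orbit x)) (λ _ → refl) ⟨
          act (act x₀ (representative x)) π   ≈⟨ act-comp x₀ (representative x) π ⟨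
          act x₀ (representative x ⨾ π)       ∎)
      }

  singleOrbit≅⟦⟧ : DecidableEquality (Carrier U) → Homogeneous → (X : GSet U) →
    (x₀ : GSet.Elt X) → (∀ x → Σ (Aut U) λ π → GSet._≈_ X (GSet.act X x₀ π) x) →
    HasLeastSupport X x₀ →
    Σ (FinStruct Sig) λ A → Embedding ⟪ A ⟫ U ×
      Σ (Subgroup ⟪ A ⟫) λ S → GSetIso X (⟦_,_⟧ {U = U} A S)
  singleOrbit≅⟦⟧ _≟_ homogeneous X x₀ orbit (C , C-supports , C-least) =
    induced C̃ , u , Orbit.S , Orbit.≅⟦A,S⟧
    where
      C̃ : List (Carrier U)
      C̃ = deduplicate _≟_ C
      !C̃ : Unique C̃
      !C̃ = deduplicate-! _≟_ C
      u : Embedding ⟪ induced C̃ ⟫ U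
      u = inclusion !C̃
      C⊆image : C ⊆ image u
      C⊆image = inclusion-image⁺ !C̃ ∘ ∈-deduplicate⁺ _≟_
      image⊆C : image u ⊆ C
      image⊆C = ∈-deduplicate⁻ _≟_ C ∘ inclusion-image⁻ !C̃
      module Orbit = OrbitIso homogeneous X x₀ orbit (induced C̃) u
        (supports-⊆ X C⊆image C-supports)
        (λ ρ∈ → C⊆image ∘ leastSupport-stable X C-supports C-least ρ∈ ∘ image⊆C)

proposition10p7 : (Sig : Signature) (K : FinStruct Sig → Set) → IsFraisseClass K →
    (U : Structure Sig) → IsFraisseLimit K U → WellBehaved {U = U} →
    ((A : FinStruct Sig) → K A → (S : Subgroup ⟪ A ⟫) →
       IsNominal (⟦_,_⟧ {U = U} A S) × SingleOrbit (⟦_,_⟧ {U = U} A S))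
    ×
    ((X : GSet U) → IsNominal X → SingleOrbit X →
       Σ (FinStruct Sig) λ A → K A × Σ (Subgroup ⟪ A ⟫) λ S →
         GSetIso X (⟦_,_⟧ {U = U} A S))
proposition10p7 Sig K _ U FL (leastSupport , _) =
    (λ A A∈K S → ⟦⟧-nominal A S , ⟦⟧-singleOrbit homogeneous A S (proj₁ (age A) A∈K))
  , λ X X-nominal (x₀ , transitive) →
      let (A , u , S , X≅⟦A,S⟧) = singleOrbit≅⟦⟧ (eq? (mk↣ (count-inj _ _))) homogeneous
                                    X x₀ (transitive x₀) (leastSupport X X-nominal x₀)
      in A , proj₂ (age A) u , S , X≅⟦A,S⟧
  where open IsFraisseLimit FL
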